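{- For every graph $G$ and any two independent sets $I_s,I_t$ of $G$, there is a reconfiguration sequence from $I_s$ to $I_t$ of length at most $\mathrm{cc}(I_s\triangle I_t)$; i.e., a shortest reconfiguration sequence has length at most $\mathrm{cc}(I_s\triangle I_t)$.
   Context: All graphs are finite, simple, undirected. For $S\subseteq V(G)$, $\mathrm{cc}(S)$ denotes the number of connected components of the induced subgraph $G[S]$. A reconfiguration sequence from $I_s$ to $I_t$ of length $\ell$ is a sequence $I_s=I_0,I_1,\dots,I_\ell=I_t$ of independent sets of $G$ such that $G[I_{i-1}\triangle I_i]$ is connected for every $i\in\{1,\dots,\ell\}$. -}

module Defs where

open import Data.Nat using (ℕ; zero; suc; _≤_)
open import Data.Bool using (Bool; true; false; _xor_)
open import Data.Fin using (Fin; zero; suc; inject₁; fromℕ)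
open import Data.Fin.Subset using (Subset; _∈_)
open import Data.Vec using (zipWith)
open import Data.Product using (Σ; _×_; _,_; ∃)
open import Relation.Binary.PropositionalEquality using (_≡_)
open import Function.Bundles using (_⇔_)

infixl 6 _Δ_
_Δ_ : ∀ {n} → Subset n → Subset n → Subset n
_Δ_ = zipWith _xor_

record Graph (n : ℕ) : Set where
  field
    adj   : Fin n → Fin n → Bool
    sym   : ∀ x y → adj x y ≡ adj y x
    irrefl : ∀ x → adj x x ≡ false
open Graph public

module _ {n : ℕ} (G : Graph n) where

  Independent : Subset n → Set
  Independent S = ∀ x y → x ∈ S → y ∈ S → adj G x y ≡ false

  data Reach (S : Subset n) : Fin n → Fin n → Set where
    here : ∀ {x} → x ∈ S → Reach S x x
    step : ∀ {x y z} → x ∈ S → adj G x y ≡ true → Reach S y z → Reach S x z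

  Connected : Subset n → Set
  Connected S = ∀ x y → x ∈ S → y ∈ S → Reach S x y

  -- cc(S) ≡ k : G[S] has exactly k connected components, witnessed by a
  -- labelling of S by Fin k that is onto and separates exactly the components.
  HasComponents : Subset n → ℕ → Set
  HasComponents S k =
    Σ (Fin n → Fin k) λ c →
      (∀ x y → x ∈ S → y ∈ S → (c x ≡ c y ⇔ Reach S x y)) ×
      (∀ (i : Fin k) → ∃ λ x → x ∈ S × c x ≡ i)

  record ReconfSeq (Is It : Subset n) (ℓ : ℕ) : Set where
    field
      seq       : Fin (suc ℓ) → Subset n
      start     : seq zero ≡ Is
      finish    : seq (fromℕ ℓ) ≡ It
      indep     : ∀ i → Independent (seq i)
      connected : ∀ (i : Fin ℓ) → Connected (seq (inject₁ i) Δ seq (suc i))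

-- Label the components of G[Is Δ It] by 0, …, k−1 and swap them from Is to It one at a time:
-- stage j takes It on the components with label < j and Is everywhere else. Consecutive stages
-- differ in exactly one component, which is connected. Each stage is independent: an edge between
-- an It-vertex and an Is-vertex of different stages would lie in G[Is Δ It] (otherwise Is or It
-- alone would contain it), so its ends would share a component and hence a label.
module Submission where

open import Defs hiding (sym)
open import Data.Bool using (Bool; true; false; _xor_; _∧_; if_then_else_)
open import Data.Bool.Properties using (xor-same; xor-comm; not-¬; ¬-not; T-≡)
open import Data.Nat using (ℕ; suc; _≤_; _<_; _<ᵇ_)
open import Data.Nat.Properties using (≤-refl; suc-injective; <⇒<ᵇ)
open import Data.Fin using (Fin; toℕ)
open import Data.Fin.Properties using (toℕ-injective; toℕ<n; toℕ-fromℕ; toℕ-inject₁)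
open import Data.Fin.Subset using (Subset; _∈_)
open import Data.Vec using (lookup; tabulate)
open import Data.Vec.Properties using ([]=⇒lookup; lookup⇒[]=; lookup-zipWith; lookup∘tabulate; tabulate-cong; tabulate∘lookup)
open import Data.Product using (Σ; _×_; _,_; proj₁; proj₂)
open import Function.Bundles using (_⇔_; mk⇔; Equivalence)
open import Relation.Binary.PropositionalEquality using (_≡_; _≢_; refl; sym; trans; cong; cong₂; subst)

open Equivalence using (to; from)

if-xor-if : ∀ u v (a b : Bool) →
  ((if u then b else a) xor (if v then b else a)) ≡ (u xor v) ∧ (a xor b)
if-xor-if true  true  a b = xor-same b
if-xor-if true  false a b = xor-comm b a
if-xor-if false true  a b = refl
if-xor-if false false a b = xor-same a

∧≡true⇔ : ∀ a b → a ∧ b ≡ true ⇔ (a ≡ true × b ≡ true)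
∧≡true⇔ true  b = mk⇔ (λ e → refl , e) proj₂
∧≡true⇔ false b = mk⇔ (λ ()) (λ ())

<ᵇ-xor-<ᵇ-suc⇔≡ : ∀ m j → (m <ᵇ j) xor (m <ᵇ suc j) ≡ true ⇔ m ≡ j
<ᵇ-xor-<ᵇ-suc⇔≡ 0       0       = mk⇔ (λ _ → refl) (λ _ → refl)
<ᵇ-xor-<ᵇ-suc⇔≡ 0       (suc j) = mk⇔ (λ ()) (λ ())
<ᵇ-xor-<ᵇ-suc⇔≡ (suc m) 0       = mk⇔ (λ ()) (λ ())
<ᵇ-xor-<ᵇ-suc⇔≡ (suc m) (suc j) =
  mk⇔ (λ e → cong suc (to (<ᵇ-xor-<ᵇ-suc⇔≡ m j) e)) (λ e → from (<ᵇ-xor-<ᵇ-suc⇔≡ m j) (suc-injective e))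

∈⇔lookup≡true : ∀ {n} {S : Subset n} {x} → x ∈ S ⇔ lookup S x ≡ true
∈⇔lookup≡true {S = S} {x} = mk⇔ []=⇒lookup (lookup⇒[]= x S)

∈Δ⇔xor : ∀ {n} {A B : Subset n} {x} → x ∈ A Δ B ⇔ (lookup A x xor lookup B x) ≡ true
∈Δ⇔xor {A = A} {B} {x} = mk⇔
  (λ h → trans (sym (lookup-zipWith _xor_ x A B)) (to ∈⇔lookup≡true h))
  (λ e → from ∈⇔lookup≡true (trans (lookup-zipWith _xor_ x A B) e))

swapOn : ∀ {n} → (Fin n → Bool) → Subset n → Subset n → Subset n
swapOn u A B = tabulate λ x → if u x then lookup B x else lookup A x

module _ {n} (A B : Subset n) where

  swapOn-none : ∀ {u} → (∀ x → u x ≡ false) → swapOn u A B ≡ A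
  swapOn-none none = trans (tabulate-cong λ x → cong (λ b → if b then _ else _) (none x)) (tabulate∘lookup A)

  swapOn-all : ∀ {u} → (∀ x → u x ≡ true) → swapOn u A B ≡ B
  swapOn-all all = trans (tabulate-cong λ x → cong (λ b → if b then _ else _) (all x)) (tabulate∘lookup B)

  ∈swapOnΔswapOn⇔ : ∀ {u v x} → x ∈ swapOn u A B Δ swapOn v A B ⇔ ((u x xor v x) ≡ true × x ∈ A Δ B)
  ∈swapOnΔswapOn⇔ {u} {v} {x} = mk⇔
    (λ h → let (p , q) = to (∧≡true⇔ _ _) (trans (sym lookup-xor) (to ∈Δ⇔xor h)) in p , from ∈Δ⇔xor q)
    (λ (p , q) → from ∈Δ⇔xor (trans lookup-xor (from (∧≡true⇔ _ _) (p , to ∈Δ⇔xor q))))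
    where
    lookup-xor : (lookup (swapOn u A B) x xor lookup (swapOn v A B) x)
               ≡ (u x xor v x) ∧ (lookup A x xor lookup B x)
    lookup-xor = trans (cong₂ _xor_ (lookup∘tabulate _ x) (lookup∘tabulate _ x))
                       (if-xor-if (u x) (v x) (lookup A x) (lookup B x))

module _ {n} (G : Graph n) where

  Reach-head : ∀ {S x y} → Reach G S x y → x ∈ S
  Reach-head (here x∈S)     = x∈S
  Reach-head (step x∈S _ _) = x∈S

  Reach-restrict : ∀ {S T} (P : Fin n → Set) →
    (∀ {x y} → x ∈ S → y ∈ S → adj G x y ≡ true → P x → P y) →
    (∀ {x} → x ∈ S → P x → x ∈ T) →
    ∀ {x y} → P x → Reach G S x y → Reach G T x y
  Reach-restrict P P-adj S∩P⊆T px (here x∈S) = here (S∩P⊆T x∈S px)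
  Reach-restrict P P-adj S∩P⊆T px (step x∈S xy r) =
    step (S∩P⊆T x∈S px) xy (Reach-restrict P P-adj S∩P⊆T (P-adj x∈S (Reach-head r) xy px) r)

  swapOn-independent : ∀ {A B u} → Independent G A → Independent G B →
    (∀ {x y} → x ∈ A Δ B → y ∈ A Δ B → adj G x y ≡ true → u x ≡ u y) →
    Independent G (swapOn u A B)
  swapOn-independent {A} {B} {u} indA indB u-adj x y x∈ y∈ =
    bySide (trans (sym (lookup∘tabulate _ x)) (to ∈⇔lookup≡true x∈))
           (trans (sym (lookup∘tabulate _ y)) (to ∈⇔lookup≡true y∈))
    where
    across : ∀ x y → lookup B x ≡ true → lookup A y ≡ true → u x ≢ u y → adj G x y ≡ false
    across x y bx ay ux≢uy with lookup A x in ax | lookup B y in by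
    ... | true  | _     = indA x y (from ∈⇔lookup≡true ax) (from ∈⇔lookup≡true ay)
    ... | false | true  = indB x y (from ∈⇔lookup≡true bx) (from ∈⇔lookup≡true by)
    ... | false | false =
      ¬-not λ xy → ux≢uy (u-adj (from ∈Δ⇔xor (cong₂ _xor_ ax bx)) (from ∈Δ⇔xor (cong₂ _xor_ ay by)) xy)

    bySide : (if u x then lookup B x else lookup A x) ≡ true →
             (if u y then lookup B y else lookup A y) ≡ true → adj G x y ≡ false
    bySide sx sy with u x in ux | u y in uy
    ... | true  | true  = indB x y (from ∈⇔lookup≡true sx) (from ∈⇔lookup≡true sy)
    ... | false | false = indA x y (from ∈⇔lookup≡true sx) (from ∈⇔lookup≡true sy)
    ... | true  | false = across x y sx sy (λ e → not-¬ ux (trans e uy))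
    ... | false | true  = trans (Graph.sym G x y) (across y x sy sx (λ e → not-¬ uy (trans e ux)))

  module _ {D : Subset n} {k} (c : Fin n → Fin k)
           (c-iff : ∀ x y → x ∈ D → y ∈ D → (c x ≡ c y ⇔ Reach G D x y)) where

    label-adj : ∀ {x y} → x ∈ D → y ∈ D → adj G x y ≡ true → c x ≡ c y
    label-adj x∈D y∈D xy = from (c-iff _ _ x∈D y∈D) (step x∈D xy (here y∈D))

    labelClass-connected : ∀ i {T} → (∀ {x} → x ∈ T ⇔ (x ∈ D × c x ≡ i)) → Connected G T
    labelClass-connected i T⇔ x y x∈T y∈T =
      Reach-restrict (λ z → c z ≡ i)
        (λ a∈D b∈D ab ca≡i → trans (sym (label-adj a∈D b∈D ab)) ca≡i)
        (λ z∈D cz≡i → from T⇔ (z∈D , cz≡i))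
        cx≡i
        (to (c-iff x y x∈D y∈D) (trans cx≡i (sym cy≡i)))
      where
      x∈D = proj₁ (to T⇔ x∈T)
      cx≡i = proj₂ (to T⇔ x∈T)
      y∈D = proj₁ (to T⇔ y∈T)
      cy≡i = proj₂ (to T⇔ y∈T)

module _ {n} (m : Fin n → ℕ) (A B : Subset n) where

  stage : ℕ → Subset n
  stage j = swapOn (λ x → m x <ᵇ j) A B

  stage-zero : stage 0 ≡ A
  stage-zero = swapOn-none A B λ _ → refl

  stage-beyond : ∀ {j} → (∀ x → m x < j) → stage j ≡ B
  stage-beyond m<j = swapOn-all A B λ x → to T-≡ (<⇒<ᵇ (m<j x))

  ∈stageΔstage-suc⇔ : ∀ {j x} → x ∈ stage j Δ stage (suc j) ⇔ (x ∈ A Δ B × m x ≡ j)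
  ∈stageΔstage-suc⇔ {j} {x} = mk⇔
    (λ h → let (e , d) = to (∈swapOnΔswapOn⇔ A B) h in d , to (<ᵇ-xor-<ᵇ-suc⇔≡ (m x) j) e)
    (λ (d , e) → from (∈swapOnΔswapOn⇔ A B) (from (<ᵇ-xor-<ᵇ-suc⇔≡ (m x) j) e , d))

mainTheorem15 : ∀ {n} (G : Graph n) (Is It : Subset n) →
    Independent G Is → Independent G It →
    (k : ℕ) → HasComponents G (Is Δ It) k →
    Σ ℕ λ ℓ → (ℓ ≤ k) × ReconfSeq G Is It ℓ
mainTheorem15 {n} G Is It indS indT k (c , c-iff , _) = k , ≤-refl , record
  { seq       = λ i → I (toℕ i)
  ; start     = stage-zero label Is It
  ; finish    = stage-beyond label Is It λ x → subst (label x <_) (sym (toℕ-fromℕ k)) (toℕ<n (c x))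
  ; indep     = λ i → swapOn-independent G indS indT λ x∈D y∈D xy →
                  cong (λ l → toℕ l <ᵇ toℕ i) (label-adj G c c-iff x∈D y∈D xy)
  ; connected = λ i → subst (λ j → Connected G (I j Δ I (suc (toℕ i)))) (sym (toℕ-inject₁ i))
                  (labelClass-connected G c c-iff i (labelClass i))
  }
  where
  label : Fin n → ℕ
  label x = toℕ (c x)

  I : ℕ → Subset n
  I = stage label Is It

  labelClass : ∀ i {x} → x ∈ I (toℕ i) Δ I (suc (toℕ i)) ⇔ (x ∈ Is Δ It × c x ≡ i)
  labelClass i = mk⇔
    (λ h → let (d , e) = to (∈stageΔstage-suc⇔ label Is It) h in d , toℕ-injective e)
    (λ (d , e) → from (∈stageΔstage-suc⇔ label Is It) (d , cong toℕ e))
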